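{- For $n\ge 1$, let $\mathrm{UFR}_n^{\uparrow}$ be the set of weakly increasing unit Fubini rankings of length $n$. Then $|\mathrm{UFR}_n^{\uparrow}|=F_{n+1}$, the $(n+1)$-th Fibonacci number, where $F_1=F_2=1$ and $F_{m+1}=F_m+F_{m-1}$.
   Context: $[n]=\{1,\ldots,n\}$. Parking process: $\alpha=(a_1,\ldots,a_n)\in[n]^n$ encodes preferences of cars $1,\ldots,n$ arriving in order at a one-way street with spots $1,\ldots,n$; car $i$ parks in spot $a_i$ if free, otherwise in the first free spot after $a_i$, if any. $\alpha$ is a parking function if all cars park. A unit interval parking function is a parking function in which each car $i$ parks in spot $a_i$ or $a_i+1$. A Fubini ranking is a tuple $(r_1,\ldots,r_n)\in[n]^n$ with $r_i=1+|\{j:r_j<r_i\}|$ for all $i$. A unit Fubini ranking is a tuple that is both a Fubini ranking and a unit interval parking function. -}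

module Defs where

open import Data.Nat using (ℕ; zero; suc; _+_; _<_; _≤_; _≟_; _<?_; _≤?_)
open import Data.Bool using (Bool; true; false; _∧_; if_then_else_)
open import Data.List using (List; []; _∷_; length; filter; concatMap; map; upTo)
open import Data.Bool.ListAction using (any; all)
open import Data.Vec using (Vec; []; _∷_; toList)
open import Data.Maybe using (Maybe; just; nothing)
open import Relation.Nullary.Decidable using (⌊_⌋)

fib : ℕ → ℕ
fib zero = 0
fib (suc zero) = 1
fib (suc (suc m)) = fib (suc m) + fib m

tuples : (n k : ℕ) → List (Vec ℕ k)
tuples n zero = [] ∷ []
tuples n (suc k) = concatMap (λ a → map (a ∷_) (tuples n k)) (map suc (upTo n))

isIn : ℕ → List ℕ → Bool
isIn x xs = any (λ y → ⌊ x ≟ y ⌋) xs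

-- first free spot s with a ≤ s ≤ n, searching upward; fuel = number of spots left to try
firstFree : (n : ℕ) → List ℕ → (a : ℕ) → (fuel : ℕ) → Maybe ℕ
firstFree n occ a zero = nothing
firstFree n occ a (suc fuel) =
  if ⌊ n <? a ⌋ then nothing
  else (if isIn a occ then firstFree n occ (suc a) fuel else just a)

park : (n : ℕ) → List ℕ → List ℕ → Maybe (List ℕ)
park n occ [] = just []
park n occ (a ∷ as) with firstFree n occ a (suc n)
... | nothing = nothing
... | just s with park n (s ∷ occ) as
...   | nothing = nothing
...   | just ss = just (s ∷ ss)

outcome : {n : ℕ} → Vec ℕ n → Maybe (List ℕ)
outcome {n} α = park n [] (toList α)

unitCheck : List ℕ → List ℕ → Bool
unitCheck [] [] = true
unitCheck (a ∷ as) (s ∷ ss) = (⌊ s ≟ a ⌋ Data.Bool.∨ ⌊ s ≟ suc a ⌋) ∧ unitCheck as ss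
unitCheck _ _ = false

isParkingFunction : {n : ℕ} → Vec ℕ n → Bool
isParkingFunction α with outcome α
... | nothing = false
... | just _ = true

isUnitIntervalPF : {n : ℕ} → Vec ℕ n → Bool
isUnitIntervalPF α with outcome α
... | nothing = false
... | just ss = unitCheck (toList α) ss

countLess : ℕ → List ℕ → ℕ
countLess x rs = length (filter (λ r → r <? x) rs)

isFubini : {n : ℕ} → Vec ℕ n → Bool
isFubini r = all (λ ri → ⌊ ri ≟ suc (countLess ri (toList r)) ⌋) (toList r)

isUnitFubini : {n : ℕ} → Vec ℕ n → Bool
isUnitFubini r = isFubini r ∧ isUnitIntervalPF r

weaklyIncreasing : List ℕ → Bool
weaklyIncreasing [] = true
weaklyIncreasing (x ∷ []) = true
weaklyIncreasing (x ∷ y ∷ xs) = ⌊ x ≤? y ⌋ ∧ weaklyIncreasing (y ∷ xs)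

UFRinc : (n : ℕ) → List (Vec ℕ n)
UFRinc n = filter (λ r → Data.Bool._≟_ (isUnitFubini r ∧ weaklyIncreasing (toList r)) true) (tuples n n)

module Submission where

-- A weakly increasing unit Fubini ranking is a concatenation of blocks (k) and (k, k), where
-- k - 1 is the number of entries before the block. Indeed, along an increasing ranking the
-- i-th car finds spots 1, ..., i - 1 taken and parks in spot i, so the unit condition forces
-- its preference to be i or i - 1, and the Fubini condition allows i - 1 only when the previous
-- entry is also i - 1, i.e. opened a block. Sequences of blocks of sizes 1 and 2 of total
-- length n are counted by the Fibonacci number F (n + 1).

open import Defs
open import Data.Nat using (ℕ; zero; suc; _+_; _≤_; _<_; _≥_; _≟_; _<?_; _≤?_; z≤n; s≤s)
open import Data.Nat.Properties
open import Data.Bool using (Bool; true; false; T; _∧_; _∨_; if_then_else_)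
import Data.Bool as Bool
open import Data.Bool.Properties using (T-∧; T-∨; ∧-zeroʳ)
open import Data.Bool.ListAction using (all)
open import Data.List using (List; []; _∷_; [_]; _++_; length; filter; concatMap; map; upTo)
open import Data.List.Properties
  using ( length-++; ++-assoc; ++-identityʳ; map-cong; map-∘; map-upTo
        ; filter-++; filter-all; filter-none; length-filter )
open import Data.Nat.ListAction using (sum)
open import Data.List.Relation.Unary.All as All using (All; []; _∷_)
open import Data.List.Relation.Unary.All.Properties using (++⁺)
open import Data.Vec using (Vec; toList) renaming (_∷_ to _V∷_)
open import Data.Vec.Properties using (length-toList)
open import Data.Maybe using (Maybe; just; nothing)
open import Data.Product using (_×_; _,_; proj₁; proj₂)
open import Data.Sum using (_⊎_; inj₁; inj₂)
open import Data.Empty using (⊥-elim)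
open import Function using (_∘_; _⇔_; mk⇔; Equivalence)
open import Relation.Nullary using (contradiction)
open import Relation.Nullary.Decidable using (⌊_⌋; yes; no; toWitness; fromWitness)
open import Relation.Binary.PropositionalEquality hiding ([_])
open import Algebra.Properties.CommutativeSemigroup +-commutativeSemigroup using (interchange)

open Equivalence using (to; from)

+-suc-≤ : ∀ {m k n} → m + suc k ≤ n → suc m + k ≤ n
+-suc-≤ {m} {k} = ≤-trans (≤-reflexive (sym (+-suc m k)))

T⇔→≡ : ∀ {x y} → T x ⇔ T y → x ≡ y
T⇔→≡ {false} {false} _   = refl
T⇔→≡ {false} {true}  x⇔y = ⊥-elim (from x⇔y _)
T⇔→≡ {true}  {false} x⇔y = ⊥-elim (to x⇔y _)
T⇔→≡ {true}  {true}  _   = refl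

countTrue : {A : Set} → (A → Bool) → List A → ℕ
countTrue p xs = length (filter (λ x → p x Bool.≟ true) xs)

countTrue-cong : {A : Set} {p q : A → Bool} → (∀ x → p x ≡ q x) →
  ∀ xs → countTrue p xs ≡ countTrue q xs
countTrue-cong p≗q [] = refl
countTrue-cong {p = p} {q} p≗q (x ∷ xs) with p x | q x | p≗q x
... | true  | .true  | refl = cong suc (countTrue-cong p≗q xs)
... | false | .false | refl = countTrue-cong p≗q xs

countTrue-++ : {A : Set} (p : A → Bool) (xs ys : List A) →
  countTrue p (xs ++ ys) ≡ countTrue p xs + countTrue p ys
countTrue-++ p xs ys = trans (cong length (filter-++ _ xs ys)) (length-++ (filter _ xs))

countTrue-concatMap : {A B : Set} (p : A → Bool) (h : B → List A) (xs : List B) →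
  countTrue p (concatMap h xs) ≡ sum (map (countTrue p ∘ h) xs)
countTrue-concatMap p h [] = refl
countTrue-concatMap p h (x ∷ xs) =
  trans (countTrue-++ p (h x) (concatMap h xs)) (cong (countTrue p (h x) +_) (countTrue-concatMap p h xs))

countTrue-map : {A B : Set} (p : A → Bool) (h : B → A) (xs : List B) →
  countTrue p (map h xs) ≡ countTrue (p ∘ h) xs
countTrue-map p h [] = refl
countTrue-map p h (x ∷ xs) with p (h x)
... | true  = cong suc (countTrue-map p h xs)
... | false = countTrue-map p h xs

countTrue-false : {A : Set} (xs : List A) → countTrue (λ _ → false) xs ≡ 0
countTrue-false []       = refl
countTrue-false (x ∷ xs) = countTrue-false xs

countTrue-∧ˡ : {A : Set} (c : Bool) (p : A → Bool) (xs : List A) →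
  countTrue (λ x → c ∧ p x) xs ≡ (if c then countTrue p xs else 0)
countTrue-∧ˡ true  p xs = refl
countTrue-∧ˡ false p xs = countTrue-false xs

sum-map-zero : {A : Set} (xs : List A) → sum (map (λ _ → 0) xs) ≡ 0
sum-map-zero []       = refl
sum-map-zero (x ∷ xs) = sum-map-zero xs

sum-map-+ : {A : Set} (f g : A → ℕ) (xs : List A) →
  sum (map (λ x → f x + g x) xs) ≡ sum (map f xs) + sum (map g xs)
sum-map-+ f g [] = refl
sum-map-+ f g (x ∷ xs) =
  trans (cong (f x + g x +_) (sum-map-+ f g xs)) (interchange (f x) (g x) (sum (map f xs)) (sum (map g xs)))

≟-suc : ∀ a c → ⌊ suc a ≟ suc c ⌋ ≡ ⌊ a ≟ c ⌋
≟-suc a c with a ≟ c | suc a ≟ suc c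
... | yes _    | yes _ = refl
... | no _     | no _  = refl
... | yes refl | no ne = contradiction refl ne
... | no ne    | yes e = contradiction (suc-injective e) ne

indicator : ℕ → ℕ → ℕ → ℕ
indicator c v a = if ⌊ a ≟ c ⌋ then v else 0

indicator-suc : ∀ c v a → indicator (suc c) v (suc a) ≡ indicator c v a
indicator-suc c v a = cong (if_then v else 0) (≟-suc a c)

range : ℕ → List ℕ
range n = map suc (upTo n)

upTo-suc : ∀ n → upTo (suc n) ≡ 0 ∷ range n
upTo-suc n = cong (0 ∷_) (sym (map-upTo suc n))

sum-map-range : ∀ (f : ℕ → ℕ) n → sum (map f (range n)) ≡ sum (map (f ∘ suc) (upTo n))
sum-map-range f n = cong sum (sym (map-∘ (upTo n)))

mutual
  sum-upTo-indicator : ∀ {c n} (v : ℕ) → c < n → sum (map (indicator c v) (upTo n)) ≡ v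
  sum-upTo-indicator {zero} {suc n} v _ = begin
    sum (map (indicator 0 v) (upTo (suc n)))  ≡⟨ cong (sum ∘ map (indicator 0 v)) (upTo-suc n) ⟩
    v + sum (map (indicator 0 v) (range n))   ≡⟨ cong (v +_) (sum-map-range (indicator 0 v) n) ⟩
    v + sum (map (λ _ → 0) (upTo n))          ≡⟨ cong (v +_) (sum-map-zero (upTo n)) ⟩
    v + 0                                     ≡⟨ +-identityʳ v ⟩
    v                                         ∎
    where open ≡-Reasoning
  sum-upTo-indicator {suc c} {suc n} v (s≤s c<n) =
    trans (cong (sum ∘ map (indicator (suc c) v)) (upTo-suc n)) (sum-range-indicator v (s≤s z≤n) c<n)

  sum-range-indicator : ∀ {c n} (v : ℕ) → 1 ≤ c → c ≤ n → sum (map (indicator c v) (range n)) ≡ v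
  sum-range-indicator {suc c} {n} v _ c<n = begin
    sum (map (indicator (suc c) v) (range n))       ≡⟨ sum-map-range (indicator (suc c) v) n ⟩
    sum (map (indicator (suc c) v ∘ suc) (upTo n))  ≡⟨ cong sum (map-cong (indicator-suc c v) (upTo n)) ⟩
    sum (map (indicator c v) (upTo n))              ≡⟨ sum-upTo-indicator v c<n ⟩
    v                                               ∎
    where open ≡-Reasoning

-- blocks m b xs: xs can follow the first m entries of such a ranking, where b records whether
-- the last of them opened a block that may still be repeated.
next : ℕ → Bool → ℕ → Bool
next m b x = ⌊ x ≟ suc m ⌋ ∨ (b ∧ ⌊ x ≟ m ⌋)

blocks : ℕ → Bool → List ℕ → Bool
blocks m b []       = true
blocks m b (x ∷ xs) = next m b x ∧ blocks (suc m) ⌊ x ≟ suc m ⌋ xs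

blockCount : (n k m : ℕ) → Bool → ℕ
blockCount n k m b = countTrue (λ v → blocks m b (toList v)) (tuples n k)

next-indicator : ∀ m b a (g : Bool → ℕ) →
  (if next m b a then g ⌊ a ≟ suc m ⌋ else 0)
    ≡ indicator (suc m) (g true) a + (if b then indicator m (g false) a else 0)
next-indicator m b a g with a ≟ suc m | a ≟ m
next-indicator m b     a g | yes refl | yes a≡m = contradiction a≡m 1+n≢n
next-indicator m true  a g | yes refl | no _    = sym (+-identityʳ _)
next-indicator m false a g | yes refl | no _    = sym (+-identityʳ _)
next-indicator m true  a g | no _     | yes _   = refl
next-indicator m false a g | no _     | yes _   = refl
next-indicator m true  a g | no _     | no _    = refl
next-indicator m false a g | no _     | no _    = refl

-- The side condition T b → 1 ≤ m rules out repeating the value 0, which is not in [n].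
blockCount-suc : ∀ {n k m} b → (T b → 1 ≤ m) → m + suc k ≤ n →
  blockCount n (suc k) m b ≡ blockCount n k (suc m) true + (if b then blockCount n k (suc m) false else 0)
blockCount-suc {n} {k} {m} b open⇒1≤m room = begin
  blockCount n (suc k) m b
    ≡⟨ countTrue-concatMap _ (λ a → map (a V∷_) (tuples n k)) (range n) ⟩
  sum (map (λ a → countTrue (λ v → blocks m b (toList v)) (map (a V∷_) (tuples n k))) (range n))
    ≡⟨ cong sum (map-cong count-∷ (range n)) ⟩
  sum (map (λ a → indicator (suc m) (C true) a + repeats b a) (range n))
    ≡⟨ sum-map-+ (indicator (suc m) (C true)) (repeats b) (range n) ⟩
  sum (map (indicator (suc m) (C true)) (range n)) + sum (map (repeats b) (range n))
    ≡⟨ cong₂ _+_ (sum-range-indicator (C true) (s≤s z≤n) m<n) (sum-repeats b open⇒1≤m) ⟩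
  C true + (if b then C false else 0)
    ∎
  where
  open ≡-Reasoning
  C : Bool → ℕ
  C = blockCount n k (suc m)
  repeats : Bool → ℕ → ℕ
  repeats c a = if c then indicator m (C false) a else 0
  m<n : m < n
  m<n = m+n≤o⇒m≤o (suc m) (+-suc-≤ room)
  count-∷ : ∀ a → countTrue (λ v → blocks m b (toList v)) (map (a V∷_) (tuples n k))
                  ≡ indicator (suc m) (C true) a + repeats b a
  count-∷ a = begin
    countTrue (λ v → blocks m b (toList v)) (map (a V∷_) (tuples n k))
      ≡⟨ countTrue-map _ (a V∷_) (tuples n k) ⟩
    countTrue (λ v → next m b a ∧ blocks (suc m) ⌊ a ≟ suc m ⌋ (toList v)) (tuples n k)
      ≡⟨ countTrue-∧ˡ (next m b a) _ (tuples n k) ⟩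
    (if next m b a then C ⌊ a ≟ suc m ⌋ else 0)
      ≡⟨ next-indicator m b a C ⟩
    indicator (suc m) (C true) a + repeats b a
      ∎
  sum-repeats : ∀ c → (T c → 1 ≤ m) → sum (map (repeats c) (range n)) ≡ (if c then C false else 0)
  sum-repeats false _   = sum-map-zero (range n)
  sum-repeats true  1≤m = sum-range-indicator (C false) (1≤m _) (<⇒≤ m<n)

blockCount-fib : ∀ {n} k m b → (T b → 1 ≤ m) → m + k ≤ n →
  blockCount n k m b ≡ (if b then fib (2 + k) else fib (1 + k))
blockCount-fib zero m true  _ _ = refl
blockCount-fib zero m false _ _ = refl
blockCount-fib {n} (suc k) m b open⇒1≤m room = begin
  blockCount n (suc k) m b
    ≡⟨ blockCount-suc b open⇒1≤m room ⟩
  blockCount n k (suc m) true + (if b then blockCount n k (suc m) false else 0)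
    ≡⟨ cong₂ _+_ (blockCount-fib k (suc m) true (λ _ → s≤s z≤n) room′)
                 (cong (if b then_else 0) (blockCount-fib k (suc m) false (λ ()) room′)) ⟩
  fib (2 + k) + (if b then fib (1 + k) else 0)
    ≡⟨ fib-step b ⟩
  (if b then fib (3 + k) else fib (2 + k))
    ∎
  where
  open ≡-Reasoning
  room′ : suc m + k ≤ n
  room′ = +-suc-≤ room
  fib-step : ∀ c → fib (2 + k) + (if c then fib (1 + k) else 0) ≡ (if c then fib (3 + k) else fib (2 + k))
  fib-step true  = refl
  fib-step false = +-identityʳ _

data Blocks : ℕ → Bool → List ℕ → Set where
  []     : ∀ {m b} → Blocks m b []
  fresh  : ∀ {m b xs} → Blocks (suc m) true xs → Blocks m b (suc m ∷ xs)
  repeat : ∀ {m xs} → Blocks (suc m) false xs → Blocks m true (m ∷ xs)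

next-view : ∀ {m b x} → T (next m b x) → x ≡ suc m ⊎ (T b × x ≡ m)
next-view {m} {b} {x} t with to T-∨ t
... | inj₁ x≡sm  = inj₁ (toWitness x≡sm)
... | inj₂ b∧x≡m = let (tb , x≡m) = to (T-∧ {b}) b∧x≡m in inj₂ (tb , toWitness x≡m)

next-suc : ∀ m b → T (next m b (suc m))
next-suc m b = from (T-∨ {⌊ suc m ≟ suc m ⌋}) (inj₁ (fromWitness refl))

next-repeat : ∀ m → T (next m true m)
next-repeat m = from (T-∨ {⌊ m ≟ suc m ⌋}) (inj₂ (fromWitness refl))

⌊≟⌋-refl : ∀ n → ⌊ n ≟ n ⌋ ≡ true
⌊≟⌋-refl n = cong ⌊_⌋ (≟-diag refl)

⌊≟⌋-suc : ∀ n → ⌊ n ≟ suc n ⌋ ≡ false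
⌊≟⌋-suc n with n ≟ suc n
... | yes n≡sn = contradiction (sym n≡sn) 1+n≢n
... | no _     = refl

blocks-sound : ∀ {m b} xs → T (blocks m b xs) → Blocks m b xs
blocks-sound [] _ = []
blocks-sound {m} {b} (x ∷ xs) t with to (T-∧ {next m b x}) t
... | tx , txs with next-view {m} {b} {x} tx
...   | inj₁ refl =
  fresh (blocks-sound xs (subst (λ c → T (blocks (suc m) c xs)) (⌊≟⌋-refl (suc m)) txs))
blocks-sound {m} {true} (x ∷ xs) t | tx , txs | inj₂ (_ , refl) =
  repeat (blocks-sound xs (subst (λ c → T (blocks (suc m) c xs)) (⌊≟⌋-suc m) txs))

blocks-complete : ∀ {m b xs} → Blocks m b xs → T (blocks m b xs)
blocks-complete [] = _
blocks-complete {m} {b} (fresh {xs = xs} bs) =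
  from T-∧ (next-suc m b , subst (λ c → T (blocks (suc m) c xs)) (sym (⌊≟⌋-refl (suc m))) (blocks-complete bs))
blocks-complete {m} (repeat {xs = xs} bs) =
  from T-∧ (next-repeat m , subst (λ c → T (blocks (suc m) c xs)) (sym (⌊≟⌋-suc m)) (blocks-complete bs))

Blocks-lowerBound : ∀ {m b xs} → Blocks m b xs → All (m ≤_) xs
Blocks-lowerBound []          = []
Blocks-lowerBound (fresh bs)  = n≤1+n _ ∷ All.map (≤-trans (n≤1+n _)) (Blocks-lowerBound bs)
Blocks-lowerBound (repeat bs) = ≤-refl ∷ All.map (≤-trans (n≤1+n _)) (Blocks-lowerBound bs)

weaklyIncreasing-∷ : ∀ x xs → All (x ≤_) xs → T (weaklyIncreasing xs) → T (weaklyIncreasing (x ∷ xs))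
weaklyIncreasing-∷ x []       _         _   = _
weaklyIncreasing-∷ x (y ∷ xs) (x≤y ∷ _) ys↑ = from T-∧ (fromWitness x≤y , ys↑)

weaklyIncreasing-tail : ∀ x xs → T (weaklyIncreasing (x ∷ xs)) → T (weaklyIncreasing xs)
weaklyIncreasing-tail x []       _   = _
weaklyIncreasing-tail x (y ∷ xs) xs↑ = proj₂ (to (T-∧ {⌊ x ≤? y ⌋}) xs↑)

weaklyIncreasing⇒head≤ : ∀ x xs → T (weaklyIncreasing (x ∷ xs)) → All (x ≤_) xs
weaklyIncreasing⇒head≤ x []       _   = []
weaklyIncreasing⇒head≤ x (y ∷ xs) xs↑ =
  x≤y ∷ All.map (≤-trans x≤y) (weaklyIncreasing⇒head≤ y xs (weaklyIncreasing-tail x (y ∷ xs) xs↑))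
  where
  x≤y : x ≤ y
  x≤y = toWitness (proj₁ (to (T-∧ {⌊ x ≤? y ⌋}) xs↑))

Blocks⇒weaklyIncreasing : ∀ {m b xs} → Blocks m b xs → T (weaklyIncreasing xs)
Blocks⇒weaklyIncreasing []          = _
Blocks⇒weaklyIncreasing (fresh bs)  =
  weaklyIncreasing-∷ _ _ (Blocks-lowerBound bs) (Blocks⇒weaklyIncreasing bs)
Blocks⇒weaklyIncreasing (repeat bs) =
  weaklyIncreasing-∷ _ _ (All.map (≤-trans (n≤1+n _)) (Blocks-lowerBound bs)) (Blocks⇒weaklyIncreasing bs)

countLess≤length : ∀ x xs → countLess x xs ≤ length xs
countLess≤length x xs = length-filter (_<? x) xs

countLess-all< : ∀ {x xs} → All (_< x) xs → countLess x xs ≡ length xs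
countLess-all< {x} xs<x = cong length (filter-all (_<? x) xs<x)

countLess-++-≥ : ∀ {x} xs {ys} → All (x ≤_) ys → countLess x (xs ++ ys) ≡ countLess x xs
countLess-++-≥ {x} xs {ys} x≤ys = begin
  length (filter (_<? x) (xs ++ ys))               ≡⟨ cong length (filter-++ (_<? x) xs ys) ⟩
  length (filter (_<? x) xs ++ filter (_<? x) ys)  ≡⟨ cong (λ zs → length (filter (_<? x) xs ++ zs)) ys<x≡[] ⟩
  length (filter (_<? x) xs ++ [])                 ≡⟨ cong length (++-identityʳ (filter (_<? x) xs)) ⟩
  length (filter (_<? x) xs)                       ∎
  where
  open ≡-Reasoning
  ys<x≡[] : filter (_<? x) ys ≡ []
  ys<x≡[] = filter-none (_<? x) (All.map ≤⇒≯ x≤ys)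

length-∷ʳ : ∀ (xs : List ℕ) x → length (xs ++ [ x ]) ≡ suc (length xs)
length-∷ʳ xs x = trans (length-++ xs) (+-comm (length xs) 1)

-- What the Fubini condition of the remaining entries needs to know about the m entries pre
-- already read.
record BlockPrefix (m : ℕ) (b : Bool) (pre : List ℕ) : Set where
  field
    length≡    : length pre ≡ m
    bounded    : All (_≤ m) pre
    countLess≡ : (if b then suc (countLess m pre) else countLess m pre) ≡ m

  countLess-suc≡ : countLess (suc m) pre ≡ m
  countLess-suc≡ = trans (countLess-all< (All.map s≤s bounded)) length≡

open BlockPrefix

prefix-[] : BlockPrefix 0 false []
prefix-[] = record { length≡ = refl ; bounded = [] ; countLess≡ = refl }

prefix-fresh : ∀ {m b pre} → BlockPrefix m b pre → BlockPrefix (suc m) true (pre ++ [ suc m ])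
prefix-fresh {m} {pre = pre} p = record
  { length≡    = trans (length-∷ʳ pre (suc m)) (cong suc (length≡ p))
  ; bounded    = ++⁺ (All.map m≤n⇒m≤1+n (bounded p)) (≤-refl ∷ [])
  ; countLess≡ = cong suc (trans (countLess-++-≥ pre (≤-refl ∷ [])) (countLess-suc≡ p))
  }

prefix-repeat : ∀ {m b pre} → BlockPrefix m b pre → BlockPrefix (suc m) false (pre ++ [ m ])
prefix-repeat {m} {pre = pre} p = record
  { length≡    = length≡′
  ; bounded    = All.map m≤n⇒m≤1+n pre∷ʳm≤m
  ; countLess≡ = trans (countLess-all< (All.map s≤s pre∷ʳm≤m)) length≡′
  }
  where
  length≡′ : length (pre ++ [ m ]) ≡ suc m
  length≡′ = trans (length-∷ʳ pre m) (cong suc (length≡ p))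
  pre∷ʳm≤m : All (_≤ m) (pre ++ [ m ])
  pre∷ʳm≤m = ++⁺ (bounded p) (≤-refl ∷ [])

occupied : ℕ → List ℕ
occupied zero    = []
occupied (suc m) = suc m ∷ occupied m

isIn-occupied : ∀ {x m} → 1 ≤ x → x ≤ m → isIn x (occupied m) ≡ true
isIn-occupied {m = zero}  (s≤s _) ()
isIn-occupied {x} {suc m} 1≤x x≤sm with x ≟ suc m
... | yes _   = refl
... | no x≢sm = isIn-occupied 1≤x (≤-pred (≤∧≢⇒< x≤sm x≢sm))

isIn-occupied-> : ∀ {x m} → m < x → isIn x (occupied m) ≡ false
isIn-occupied-> {m = zero}  _ = refl
isIn-occupied-> {x} {suc m} sm<x with x ≟ suc m
... | yes refl = contradiction sm<x (<-irrefl refl)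
... | no _     = isIn-occupied-> (<-trans (n<1+n m) sm<x)

firstFree-occupied : ∀ {n m x} f → 1 ≤ x → x ≤ suc m → suc m ≤ n → suc m ≤ x + f →
  firstFree n (occupied m) x (suc f) ≡ just (suc m)
firstFree-occupied {n} {m} {x} f 1≤x x≤sm sm≤n sm≤x+f with n <? x
... | yes n<x = contradiction (≤-trans x≤sm sm≤n) (<⇒≱ n<x)
... | no _ with m≤n⇒m<n∨m≡n x≤sm
...   | inj₂ refl rewrite isIn-occupied-> {x} {m} ≤-refl = refl
firstFree-occupied {n} {m} {x} zero 1≤x x≤sm sm≤n sm≤x+0 | no _ | inj₁ x<sm =
  contradiction (≤-trans sm≤x+0 (≤-reflexive (+-identityʳ x))) (<⇒≱ x<sm)
firstFree-occupied {n} {m} {x} (suc f) 1≤x x≤sm sm≤n sm≤x+sf | no _ | inj₁ x<sm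
  rewrite isIn-occupied 1≤x (≤-pred x<sm) =
  firstFree-occupied f (s≤s z≤n) x<sm sm≤n (≤-trans sm≤x+sf (≤-reflexive (+-suc x f)))

unitSpot : ℕ → ℕ → Bool
unitSpot s a = ⌊ s ≟ a ⌋ ∨ ⌊ s ≟ suc a ⌋

unitSpot-refl : ∀ x → T (unitSpot x x)
unitSpot-refl x = from (T-∨ {⌊ x ≟ x ⌋}) (inj₁ (fromWitness refl))

unitSpot-suc : ∀ x → T (unitSpot (suc x) x)
unitSpot-suc x = from (T-∨ {⌊ suc x ≟ x ⌋}) (inj₂ (fromWitness refl))

unitSpot-view : ∀ {m x} → T (unitSpot (suc m) x) → x ≡ suc m ⊎ x ≡ m
unitSpot-view {m} {x} t with to (T-∨ {⌊ suc m ≟ x ⌋}) t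
... | inj₁ sm≡x  = inj₁ (sym (toWitness sm≡x))
... | inj₂ sm≡sx = inj₂ (sym (suc-injective (toWitness sm≡sx)))

unitOutcome : List ℕ → Maybe (List ℕ) → Bool
unitOutcome as nothing   = false
unitOutcome as (just ss) = unitCheck as ss

isUnitIntervalPF≡unitOutcome : ∀ {n} (r : Vec ℕ n) → isUnitIntervalPF r ≡ unitOutcome (toList r) (outcome r)
isUnitIntervalPF≡unitOutcome r with outcome r
... | nothing = refl
... | just _  = refl

unitOutcome-park-∷ : ∀ {n occ x t} s → firstFree n occ x (suc n) ≡ just t →
  unitOutcome (x ∷ s) (park n occ (x ∷ s)) ≡ unitSpot t x ∧ unitOutcome s (park n (t ∷ occ) s)
unitOutcome-park-∷ {n} {occ} {x} {t} s parks-at-t rewrite parks-at-t with park n (t ∷ occ) s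
... | nothing = sym (∧-zeroʳ (unitSpot t x))
... | just _  = refl

unitOutcome-park-occupied : ∀ {n m x} s → 1 ≤ x → x ≤ suc m → suc m ≤ n →
  unitOutcome (x ∷ s) (park n (occupied m) (x ∷ s))
    ≡ unitSpot (suc m) x ∧ unitOutcome s (park n (occupied (suc m)) s)
unitOutcome-park-occupied {n} {x = x} s 1≤x x≤sm sm≤n =
  unitOutcome-park-∷ s (firstFree-occupied n 1≤x x≤sm sm≤n (≤-trans sm≤n (m≤n+m n x)))

fubiniAt : List ℕ → ℕ → Bool
fubiniAt l x = ⌊ x ≟ suc (countLess x l) ⌋

Blocks⇒fubini : ∀ {m b pre s} → BlockPrefix m b pre → Blocks m b s → T (all (fubiniAt (pre ++ s)) s)
Blocks⇒fubini _ [] = _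
Blocks⇒fubini {m} {pre = pre} p (fresh {xs = s} bs) =
  from T-∧ (fromWitness fubini , subst (λ l → T (all (fubiniAt l) s)) (++-assoc pre [ suc m ] s) rest)
  where
  fubini : suc m ≡ suc (countLess (suc m) (pre ++ suc m ∷ s))
  fubini = cong suc (sym (trans (countLess-++-≥ pre (≤-refl ∷ Blocks-lowerBound bs)) (countLess-suc≡ p)))
  rest : T (all (fubiniAt ((pre ++ [ suc m ]) ++ s)) s)
  rest = Blocks⇒fubini (prefix-fresh p) bs
Blocks⇒fubini {m} {pre = pre} p (repeat {xs = s} bs) =
  from T-∧ (fromWitness fubini , subst (λ l → T (all (fubiniAt l) s)) (++-assoc pre [ m ] s) rest)
  where
  m≤s : All (m ≤_) (m ∷ s)
  m≤s = ≤-refl ∷ All.map (≤-trans (n≤1+n m)) (Blocks-lowerBound bs)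
  fubini : m ≡ suc (countLess m (pre ++ m ∷ s))
  fubini = trans (sym (countLess≡ p)) (cong suc (sym (countLess-++-≥ pre m≤s)))
  rest : T (all (fubiniAt ((pre ++ [ m ]) ++ s)) s)
  rest = Blocks⇒fubini (prefix-repeat p) bs

Blocks⇒unitOutcome : ∀ {n m b s} → Blocks m b s → (T b → 1 ≤ m) → m + length s ≤ n →
  T (unitOutcome s (park n (occupied m) s))
Blocks⇒unitOutcome [] _ _ = _
Blocks⇒unitOutcome {n} {m} (fresh {xs = s} bs) _ room
  rewrite unitOutcome-park-occupied {n} s (s≤s z≤n) ≤-refl (m+n≤o⇒m≤o (suc m) (+-suc-≤ room)) =
  from T-∧ (unitSpot-refl (suc m) , Blocks⇒unitOutcome bs (λ _ → s≤s z≤n) (+-suc-≤ room))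
Blocks⇒unitOutcome {n} {m} (repeat {xs = s} bs) open⇒1≤m room
  rewrite unitOutcome-park-occupied {n} s (open⇒1≤m _) (n≤1+n m) (m+n≤o⇒m≤o (suc m) (+-suc-≤ room)) =
  from T-∧ (unitSpot-suc m , Blocks⇒unitOutcome bs (λ ()) (+-suc-≤ room))

Blocks-repeat : ∀ {m b pre xs} → BlockPrefix m b pre → m ≡ suc (countLess m pre) →
  Blocks (suc m) false xs → Blocks m b (m ∷ xs)
Blocks-repeat {b = true}  _ _  bs = repeat bs
Blocks-repeat {b = false} p m≡ _  = contradiction (sym (trans (countLess≡ p) m≡)) 1+n≢n

unitFubini⇒Blocks : ∀ {n m b pre} s → BlockPrefix m b pre → m + length s ≤ n → T (weaklyIncreasing s) →
  T (all (fubiniAt (pre ++ s)) s) → T (unitOutcome s (park n (occupied m) s)) → Blocks m b s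
unitFubini⇒Blocks [] _ _ _ _ _ = []
unitFubini⇒Blocks {n} {m} {b} {pre} (x ∷ s) p room s↑ fubini unit = block (unitSpot-view spot)
  where
  fubiniˣ : T (fubiniAt (pre ++ x ∷ s) x)
  fubiniˣ = proj₁ (to (T-∧ {fubiniAt (pre ++ x ∷ s) x}) fubini)
  fubiniˢ : T (all (fubiniAt ((pre ++ [ x ]) ++ s)) s)
  fubiniˢ = subst (λ l → T (all (fubiniAt l) s)) (sym (++-assoc pre [ x ] s))
                  (proj₂ (to (T-∧ {fubiniAt (pre ++ x ∷ s) x}) fubini))
  x≡ : x ≡ suc (countLess x pre)
  x≡ = trans (toWitness fubiniˣ) (cong suc (countLess-++-≥ pre (≤-refl ∷ weaklyIncreasing⇒head≤ x s s↑)))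
  x≤sm : x ≤ suc m
  x≤sm = subst (_≤ suc m) (sym x≡) (s≤s (≤-trans (countLess≤length x pre) (≤-reflexive (length≡ p))))
  parked : T (unitSpot (suc m) x ∧ unitOutcome s (park n (occupied (suc m)) s))
  parked = subst T (unitOutcome-park-occupied s (subst (1 ≤_) (sym x≡) (s≤s z≤n)) x≤sm
                                              (m+n≤o⇒m≤o (suc m) (+-suc-≤ room))) unit
  spot : T (unitSpot (suc m) x)
  spot = proj₁ (to (T-∧ {unitSpot (suc m) x}) parked)
  rest : ∀ {b′} → BlockPrefix (suc m) b′ (pre ++ [ x ]) → Blocks (suc m) b′ s
  rest p′ = unitFubini⇒Blocks s p′ (+-suc-≤ room) (weaklyIncreasing-tail x s s↑) fubiniˢ
                              (proj₂ (to (T-∧ {unitSpot (suc m) x}) parked))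
  block : x ≡ suc m ⊎ x ≡ m → Blocks m b (x ∷ s)
  block (inj₁ refl) = fresh (rest (prefix-fresh p))
  block (inj₂ refl) = Blocks-repeat p x≡ (rest (prefix-repeat p))

weaklyIncreasingUnitFubini≡blocks : ∀ {n} (r : Vec ℕ n) →
  (isUnitFubini r ∧ weaklyIncreasing (toList r)) ≡ blocks 0 false (toList r)
weaklyIncreasingUnitFubini≡blocks {n} r = T⇔→≡ (mk⇔ ⇒blocks blocks⇒)
  where
  l : List ℕ
  l = toList r
  room : 0 + length l ≤ n
  room = ≤-reflexive (length-toList r)
  ⇒blocks : T (isUnitFubini r ∧ weaklyIncreasing l) → T (blocks 0 false l)
  ⇒blocks t = blocks-complete (unitFubini⇒Blocks l prefix-[] room l↑ fubini unit)
    where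
    ufr : T (isUnitFubini r)
    ufr = proj₁ (to (T-∧ {isUnitFubini r}) t)
    l↑ : T (weaklyIncreasing l)
    l↑ = proj₂ (to (T-∧ {isUnitFubini r}) t)
    fubini : T (isFubini r)
    fubini = proj₁ (to (T-∧ {isFubini r}) ufr)
    unit : T (unitOutcome l (outcome r))
    unit = subst T (isUnitIntervalPF≡unitOutcome r) (proj₂ (to (T-∧ {isFubini r}) ufr))
  blocks⇒ : T (blocks 0 false l) → T (isUnitFubini r ∧ weaklyIncreasing l)
  blocks⇒ t = from T-∧ (from T-∧ (Blocks⇒fubini prefix-[] bs , unit) , Blocks⇒weaklyIncreasing bs)
    where
    bs : Blocks 0 false l
    bs = blocks-sound l t
    unit : T (isUnitIntervalPF r)
    unit = subst T (sym (isUnitIntervalPF≡unitOutcome r)) (Blocks⇒unitOutcome bs (λ ()) room)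

theorem3p8 : (n : ℕ) → n ≥ 1 → length (UFRinc n) ≡ fib (suc n)
theorem3p8 n _ = begin
  length (UFRinc n)       ≡⟨ countTrue-cong weaklyIncreasingUnitFubini≡blocks (tuples n n) ⟩
  blockCount n n 0 false  ≡⟨ blockCount-fib n 0 false (λ ()) ≤-refl ⟩
  fib (suc n)             ∎
  where open ≡-Reasoning
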